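{- Consider the directed star $K_{1,n}$ with every arc oriented from the center towards the leaves, and let $S_n$ be a digraph obtained from it by substituting every leaf with a directed cycle of odd length (i.e., each leaf is a vertex of its own directed odd cycle, these cycles being pairwise vertex-disjoint and not containing the center). Then for every integer $n\geq 2$, $\kappa(S_n)=cic(S_n)$, where $cic(S_n)$ is the number of directed cycles of $S_n$.
   Context: A kernel of a digraph $D$ is a set $N\subseteq V(D)$ that is independent (no arc between two vertices of $N$) and absorbent (for every $u\in V(D)\setminus N$ there is $v\in N$ with $(u,v)\in A(D)$). Subdividing an arc $(u,v)$ means replacing it by a new vertex $a$ and the arcs $(u,a),(a,v)$. For $\Lambda\subseteq A(D)$, $D_\Lambda$ is obtained from $D$ by subdividing every arc of $\Lambda$. $\kappa(D)$ is the smallest cardinality of $\Lambda\subseteq A(D)$ such that $D_\Lambda$ has a kernel. -}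

module Defs where

open import Data.Nat using (ℕ; zero; suc; _+_; _*_; _≤_; _<?_)
open import Data.Fin using (Fin; zero; suc; toℕ; fromℕ<)
open import Data.Bool using (Bool; true; false; if_then_else_)
open import Data.List using (List; map; allFin)
open import Data.Nat.ListAction using (sum)
open import Data.Vec using (Vec; lookup)
open import Data.Product using (Σ; _×_; _,_; proj₁; proj₂)
open import Data.Sum using (_⊎_)
open import Data.Empty using (⊥)
open import Relation.Nullary using (¬_; yes; no)
open import Relation.Binary.PropositionalEquality using (_≡_)
import Data.Fin as F

record Digraph : Set₁ where
  field
    V   : Set
    Arc : V → V → Set
open Digraph public

IsKernel : (D : Digraph) → (V D → Bool) → Set
IsKernel D N =
  (∀ u v → N u ≡ true → N v ≡ true → ¬ Arc D u v) ×
  (∀ u → ¬ (N u ≡ true) → Σ (V D) λ v → N v ≡ true × Arc D u v)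

HasKernel : Digraph → Set
HasKernel D = Σ (V D → Bool) (IsKernel D)

FinDigraph : ℕ → Set
FinDigraph m = Fin m → Fin m → Bool

toDigraph : ∀ {m} → FinDigraph m → Digraph
toDigraph {m} A = record { V = Fin m ; Arc = λ u v → A u v ≡ true }

ArcSubset : ∀ {m} → FinDigraph m → Set
ArcSubset {m} A = Σ (Fin m → Fin m → Bool) λ Λ → ∀ u v → Λ u v ≡ true → A u v ≡ true

card : ∀ {m} {A : FinDigraph m} → ArcSubset A → ℕ
card {m} (Λ , _) =
  sum (map (λ u → sum (map (λ v → if Λ u v then 1 else 0) (allFin m))) (allFin m))

-- D_Λ : every arc of Λ is replaced by a new vertex a and arcs (u,a),(a,v)
data SubVertex {m} (A : FinDigraph m) (Λ : ArcSubset A) : Set where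
  old : Fin m → SubVertex A Λ
  new : (u v : Fin m) → proj₁ Λ u v ≡ true → SubVertex A Λ

SubArc : ∀ {m} (A : FinDigraph m) (Λ : ArcSubset A) → SubVertex A Λ → SubVertex A Λ → Set
SubArc A Λ (old u) (old v) = A u v ≡ true × proj₁ Λ u v ≡ false
SubArc A Λ (old u) (new u' v' _) = u ≡ u'
SubArc A Λ (new u' v' _) (old v) = v ≡ v'
SubArc A Λ (new _ _ _) (new _ _ _) = ⊥

subdivide : ∀ {m} (A : FinDigraph m) → ArcSubset A → Digraph
subdivide A Λ = record { V = SubVertex A Λ ; Arc = SubArc A Λ }

IsKappa : ∀ {m} → FinDigraph m → ℕ → Set
IsKappa A k =
  (Σ (ArcSubset A) λ Λ → card Λ ≡ k × HasKernel (subdivide A Λ)) ×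
  (∀ (Λ : ArcSubset A) → HasKernel (subdivide A Λ) → k ≤ card Λ)

next : ∀ {k} → Fin k → Fin k
next {suc k} i with suc (toℕ i) <? suc k
... | yes p = fromℕ< p
... | no _ = zero

-- A directed cycle v₀ → v₁ → … → v_len → v₀ with distinct vertices,
-- written canonically starting at its least vertex (so each directed
-- cycle is represented exactly once).  Proof fields are irrelevant, so a
-- cycle is determined by its vertex sequence.
record DirCycle {m} (A : FinDigraph m) : Set where
  field
    len       : ℕ
    walk      : Vec (Fin m) (suc len)
    .distinct : ∀ i j → lookup walk i ≡ lookup walk j → i ≡ j
    .closed   : ∀ i → A (lookup walk i) (lookup walk (next i)) ≡ true
    .canon    : ∀ i → lookup walk zero F.≤ lookup walk i

-- Along an arc that is not subdivided and leaves a vertex of out-degree one, membership in a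
-- kernel alternates, and an odd cycle admits no alternating 2-colouring.  So every subdivision
-- of S_n with a kernel subdivides an arc on each of the n vertex-disjoint cycles: κ(S_n) ≥ n.
-- Subdividing the closing arc of each cycle (from its last vertex back to the leaf) suffices:
-- the centre, the subdivision vertices and the odd-indexed cycle vertices form a kernel.
-- The centre has no in-arcs and every cycle vertex has out-degree one, so the directed cycles
-- of S_n are exactly these n cycles.

module Submission where

open import Defs
open import Data.Nat using (ℕ; zero; suc; _+_; _*_; _∸_; _≤_; _<_; z≤n; s≤s; s≤s⁻¹; s<s; s<s⁻¹; _<?_; NonZero)
open import Data.Nat.Properties
open import Data.Nat.DivMod using (_%_; %-distribˡ-+; m%n%n≡m%n; m%n<n; m<n⇒m%n≡m; [m+n]%n≡m%n; n%n≡0)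
open import Data.Nat.GeneralisedArithmetic using (fold)
open import Data.Nat.ListAction using (sum)
open import Algebra.Properties.CommutativeSemigroup +-commutativeSemigroup using (x∙yz≈y∙xz)
open import Data.Fin using (Fin; zero; suc; toℕ; fromℕ; fromℕ<)
open import Data.Fin.Properties using (toℕ-injective; toℕ-fromℕ<; toℕ-fromℕ; fromℕ<-toℕ; toℕ<n; any?)
  renaming (_≟_ to _≟ᶠ_; suc-injective to suc-injectiveᶠ; 0≢1+n to 0≢1+nᶠ)
open import Data.Bool using (Bool; true; false; not; if_then_else_)
import Data.Bool.Properties as Bool
open import Data.List as List using ()
open import Data.List.Properties using (map-tabulate) renaming (tabulate-cong to List-tabulate-cong)
open import Data.Vec as Vec using (lookup)
open import Data.Vec.Properties using (lookup∘tabulate; tabulate∘lookup; tabulate-cong)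
open import Data.Vec.Functional using (updateAt)
open import Data.Vec.Functional.Properties using (updateAt-updates; updateAt-minimal)
open import Data.Product using (Σ; _×_; _,_; proj₁; proj₂)
open import Data.Product.Properties using (,-injectiveʳ-UIP)
open import Data.Sum using (_⊎_; inj₁; inj₂)
open import Data.Empty using (⊥-elim)
open import Function.Base using (_∘_; id; const)
open import Function.Bundles using (_↔_; _⇔_; Equivalence; mk↔ₛ′)
open import Function.Definitions using (Injective)
open import Relation.Binary.Definitions using (tri<; tri≈; tri>)
open import Relation.Nullary using (¬_; yes; no; does)
open import Relation.Nullary.Decidable using (recompute; dec-true; _×-dec_)
open import Relation.Binary.PropositionalEquality
open import Axiom.UniquenessOfIdentityProofs using (module Decidable⇒UIP)
open ≡-Reasoning

-- The cyclic successor and its iterates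

next-cases : ∀ {K} (j : Fin (suc K)) →
  (toℕ j < K × toℕ (next j) ≡ suc (toℕ j)) ⊎ (toℕ j ≡ K × next j ≡ zero)
next-cases {K} j with suc (toℕ j) <? suc K
... | yes 1+j<1+K = inj₁ (s<s⁻¹ 1+j<1+K , toℕ-fromℕ< 1+j<1+K)
... | no 1+j≮1+K = inj₂ (≤-antisym (s≤s⁻¹ (toℕ<n j)) (≮⇒≥ (1+j≮1+K ∘ s<s)) , refl)

next-fromℕ : ∀ K → next (fromℕ K) ≡ zero
next-fromℕ K with next-cases (fromℕ K)
... | inj₁ (K<K , _) = ⊥-elim (<-irrefl (toℕ-fromℕ K) K<K)
... | inj₂ (_ , next≡zero) = next≡zero

toℕ-next : ∀ {K} (j : Fin (suc K)) → toℕ (next j) ≡ suc (toℕ j) % suc K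
toℕ-next {K} j with next-cases j
... | inj₁ (j<K , toℕ-next≡) = trans toℕ-next≡ (sym (m<n⇒m%n≡m (s<s j<K)))
... | inj₂ (j≡K , next≡zero) =
  trans (cong toℕ next≡zero) (sym (trans (cong (λ x → suc x % suc K) j≡K) (n%n≡0 (suc K))))

[m%d+n]%d≡[m+n]%d : ∀ m n d .{{_ : NonZero d}} → (m % d + n) % d ≡ (m + n) % d
[m%d+n]%d≡[m+n]%d m n d = begin
  (m % d + n) % d           ≡⟨ %-distribˡ-+ (m % d) n d ⟩
  (m % d % d + n % d) % d   ≡⟨ cong (λ x → (x + n % d) % d) (m%n%n≡m%n m d) ⟩
  (m % d + n % d) % d       ≡⟨ %-distribˡ-+ m n d ⟨
  (m + n) % d               ∎

[m+n%d]%d≡[m+n]%d : ∀ m n d .{{_ : NonZero d}} → (m + n % d) % d ≡ (m + n) % d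
[m+n%d]%d≡[m+n]%d m n d = begin
  (m + n % d) % d   ≡⟨ cong (_% d) (+-comm m (n % d)) ⟩
  (n % d + m) % d   ≡⟨ [m%d+n]%d≡[m+n]%d n m d ⟩
  (n + m) % d       ≡⟨ cong (_% d) (+-comm n m) ⟩
  (m + n) % d       ∎

next^ : ∀ {K} → ℕ → Fin (suc K) → Fin (suc K)
next^ k s = fold s next k

module _ {K : ℕ} where

  private
    L : ℕ
    L = suc K

    a+[x+[L∸a]]≡x+L : ∀ x {a} → a ≤ L → a + (x + (L ∸ a)) ≡ x + L
    a+[x+[L∸a]]≡x+L x {a} a≤L = trans (x∙yz≈y∙xz a x (L ∸ a)) (cong (x +_) (m+[n∸m]≡n a≤L))

  toℕ-next^ : ∀ k (s : Fin L) → toℕ (next^ k s) ≡ (toℕ s + k) % L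
  toℕ-next^ zero s = sym (trans (cong (_% L) (+-identityʳ (toℕ s))) (m<n⇒m%n≡m (toℕ<n s)))
  toℕ-next^ (suc k) s = begin
    toℕ (next (next^ k s))            ≡⟨ toℕ-next (next^ k s) ⟩
    suc (toℕ (next^ k s)) % L         ≡⟨ cong (λ x → suc x % L) (toℕ-next^ k s) ⟩
    (1 + (toℕ s + k) % L) % L         ≡⟨ [m+n%d]%d≡[m+n]%d 1 (toℕ s + k) L ⟩
    suc (toℕ s + k) % L               ≡⟨ cong (_% L) (+-suc (toℕ s) k) ⟨
    (toℕ s + suc k) % L               ∎

  next^-period : ∀ (s : Fin L) → next^ L s ≡ s
  next^-period s = toℕ-injective (begin
    toℕ (next^ L s)     ≡⟨ toℕ-next^ L s ⟩
    (toℕ s + L) % L     ≡⟨ [m+n]%n≡m%n (toℕ s) L ⟩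
    toℕ s % L           ≡⟨ m<n⇒m%n≡m (toℕ<n s) ⟩
    toℕ s               ∎)

  next^-toℕ-next : ∀ (s j : Fin L) → next^ (toℕ (next j)) s ≡ next (next^ (toℕ j) s)
  next^-toℕ-next s j with next-cases j
  ... | inj₁ (_ , toℕ-next≡) = cong (λ k → next^ k s) toℕ-next≡
  ... | inj₂ (j≡K , next≡zero) = begin
    next^ (toℕ (next j)) s     ≡⟨ cong (λ x → next^ (toℕ x) s) next≡zero ⟩
    s                          ≡⟨ next^-period s ⟨
    next (next^ K s)           ≡⟨ cong (λ k → next (next^ k s)) j≡K ⟨
    next (next^ (toℕ j) s)     ∎

  next^-zero : ∀ k (k<L : k < L) → next^ k zero ≡ fromℕ< k<L
  next^-zero k k<L = toℕ-injective (trans (toℕ-next^ k zero) (trans (m<n⇒m%n≡m k<L) (sym (toℕ-fromℕ< k<L))))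

  -- Adding L ∸ toℕ s undoes the shift by toℕ s in toℕ-next^.
  distance : Fin L → Fin L → ℕ
  distance s j = (toℕ j + (L ∸ toℕ s)) % L

  distance-next^ : ∀ k (s : Fin L) → k < L → distance s (next^ k s) ≡ k
  distance-next^ k s k<L = begin
    (toℕ (next^ k s) + (L ∸ toℕ s)) % L     ≡⟨ cong (λ x → (x + (L ∸ toℕ s)) % L) (toℕ-next^ k s) ⟩
    ((toℕ s + k) % L + (L ∸ toℕ s)) % L     ≡⟨ [m%d+n]%d≡[m+n]%d (toℕ s + k) (L ∸ toℕ s) L ⟩
    (toℕ s + k + (L ∸ toℕ s)) % L           ≡⟨ cong (_% L) (+-assoc (toℕ s) k (L ∸ toℕ s)) ⟩
    (toℕ s + (k + (L ∸ toℕ s))) % L         ≡⟨ cong (_% L) (a+[x+[L∸a]]≡x+L k (<⇒≤ (toℕ<n s))) ⟩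
    (k + L) % L                             ≡⟨ [m+n]%n≡m%n k L ⟩
    k % L                                   ≡⟨ m<n⇒m%n≡m k<L ⟩
    k                                       ∎

  next^-distance : ∀ (s j : Fin L) → next^ (distance s j) s ≡ j
  next^-distance s j = toℕ-injective (begin
    toℕ (next^ (distance s j) s)                 ≡⟨ toℕ-next^ (distance s j) s ⟩
    (toℕ s + (toℕ j + (L ∸ toℕ s)) % L) % L      ≡⟨ [m+n%d]%d≡[m+n]%d (toℕ s) (toℕ j + (L ∸ toℕ s)) L ⟩
    (toℕ s + (toℕ j + (L ∸ toℕ s))) % L          ≡⟨ cong (_% L) (a+[x+[L∸a]]≡x+L (toℕ j) (<⇒≤ (toℕ<n s))) ⟩
    (toℕ j + L) % L                              ≡⟨ [m+n]%n≡m%n (toℕ j) L ⟩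
    toℕ j % L                                    ≡⟨ m<n⇒m%n≡m (toℕ<n j) ⟩
    toℕ j                                        ∎)

  next^-injective : ∀ {k k′} (s : Fin L) → k < L → k′ < L → next^ k s ≡ next^ k′ s → k ≡ k′
  next^-injective {k} {k′} s k<L k′<L e = begin
    k                          ≡⟨ distance-next^ k s k<L ⟨
    distance s (next^ k s)     ≡⟨ cong (distance s) e ⟩
    distance s (next^ k′ s)    ≡⟨ distance-next^ k′ s k′<L ⟩
    k′                         ∎

  next^-surjective : ∀ (s j : Fin L) → Σ ℕ λ k → k < L × next^ k s ≡ j
  next^-surjective s j = distance s j , m%n<n (toℕ j + (L ∸ toℕ s)) L , next^-distance s j

odd : ℕ → Bool
odd zero = false
odd (suc n) = not (odd n)

odd-2* : ∀ n → odd (2 * n) ≡ false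
odd-2* zero = refl
odd-2* (suc n) = begin
  not (odd (n + suc (n + 0)))     ≡⟨ cong (not ∘ odd) (+-suc n (n + 0)) ⟩
  not (not (odd (2 * n)))         ≡⟨ Bool.not-involutive _ ⟩
  odd (2 * n)                     ≡⟨ odd-2* n ⟩
  false                           ∎

odd-2+2* : ∀ n → odd (2 + 2 * n) ≡ false
odd-2+2* n = trans (Bool.not-involutive _) (odd-2* n)

odd-next : ∀ t (j : Fin (3 + 2 * t)) → odd (toℕ j) ≡ true → odd (toℕ (next j)) ≡ false
odd-next t j odd-j with next-cases j
... | inj₁ (_ , toℕ-next≡) = trans (cong odd toℕ-next≡) (cong not odd-j)
... | inj₂ (j≡last , _) with () ← trans (sym odd-j) (trans (cong odd j≡last) (odd-2+2* t))

odd-cycle-not-alternating : ∀ t (f : Fin (3 + 2 * t) → Bool) → ¬ (∀ j → f (next j) ≡ not (f j))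
odd-cycle-not-alternating t f alternating = Bool.not-¬ refl (begin
  f zero                                  ≡⟨ cong f (next^-period zero) ⟨
  f (next (next^ (2 + 2 * t) zero))       ≡⟨ alternating _ ⟩
  not (f (next^ (2 + 2 * t) zero))        ≡⟨ cong (λ k → not (f (next^ k zero))) (*-suc 2 t) ⟨
  not (f (next^ (2 * suc t) zero))        ≡⟨ cong not (even-steps (suc t)) ⟩
  not (f zero)                            ∎)
  where
  even-steps : ∀ u → f (next^ (2 * u) zero) ≡ f zero
  even-steps zero = refl
  even-steps (suc u) = begin
    f (next^ (2 * suc u) zero)                ≡⟨ cong (λ k → f (next^ k zero)) (*-suc 2 u) ⟩
    f (next (next (next^ (2 * u) zero)))      ≡⟨ alternating _ ⟩
    not (f (next (next^ (2 * u) zero)))       ≡⟨ cong not (alternating _) ⟩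
    not (not (f (next^ (2 * u) zero)))        ≡⟨ Bool.not-involutive _ ⟩
    f (next^ (2 * u) zero)                    ≡⟨ even-steps u ⟩
    f zero                                    ∎

-- Finite sums and the cardinality of an arc set

∑ : ∀ {m} → (Fin m → ℕ) → ℕ
∑ w = sum (List.tabulate w)

module _ {m : ℕ} where

  ∑-cong : ∀ {v w : Fin m → ℕ} → (∀ u → v u ≡ w u) → ∑ v ≡ ∑ w
  ∑-cong v≗w = cong sum (List-tabulate-cong v≗w)

  ∑-zero : ∀ (w : Fin m → ℕ) → (∀ u → w u ≡ 0) → ∑ w ≡ 0
  ∑-zero w w≗0 = trans (∑-cong w≗0) (zeros m)
    where
    zeros : ∀ k → ∑ {k} (const 0) ≡ 0
    zeros zero = refl
    zeros (suc k) = zeros k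

∑-ones : ∀ n → ∑ {n} (const 1) ≡ n
∑-ones zero = refl
∑-ones (suc n) = cong suc (∑-ones n)

∑-mono-≤ : ∀ {n} {v w : Fin n → ℕ} → (∀ i → v i ≤ w i) → ∑ v ≤ ∑ w
∑-mono-≤ {zero} _ = z≤n
∑-mono-≤ {suc n} v≤w = +-mono-≤ (v≤w zero) (∑-mono-≤ (v≤w ∘ suc))

∑-updateAt : ∀ {m} (w : Fin m → ℕ) u → ∑ w ≡ w u + ∑ (updateAt w u (const 0))
∑-updateAt {suc m} w zero = refl
∑-updateAt {suc m} w (suc u) = begin
  w zero + ∑ (w ∘ suc)                                            ≡⟨ cong (w zero +_) (∑-updateAt (w ∘ suc) u) ⟩
  w zero + (w (suc u) + ∑ (updateAt (w ∘ suc) u (const 0)))       ≡⟨ x∙yz≈y∙xz (w zero) (w (suc u)) _ ⟩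
  w (suc u) + (w zero + ∑ (updateAt (w ∘ suc) u (const 0)))       ∎

entry≤∑ : ∀ {m} (w : Fin m → ℕ) u → w u ≤ ∑ w
entry≤∑ w u = subst (w u ≤_) (sym (∑-updateAt w u)) (m≤m+n (w u) _)

∑∘h≡head+∑∘tail : ∀ {m n} (h : Fin (suc n) → Fin m) → Injective _≡_ _≡_ h → (w : Fin m → ℕ) →
  ∑ (w ∘ h) ≡ w (h zero) + ∑ (updateAt w (h zero) (const 0) ∘ h ∘ suc)
∑∘h≡head+∑∘tail h h-injective w = cong (w (h zero) +_) (∑-cong λ i →
  sym (updateAt-minimal (h (suc i)) (h zero) w (0≢1+nᶠ ∘ sym ∘ h-injective)))

∑-∘-≤ : ∀ {m n} (h : Fin n → Fin m) → Injective _≡_ _≡_ h → (w : Fin m → ℕ) → ∑ (w ∘ h) ≤ ∑ w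
∑-∘-≤ {n = zero} h _ w = z≤n
∑-∘-≤ {n = suc n} h h-injective w =
  subst₂ _≤_ (sym (∑∘h≡head+∑∘tail h h-injective w)) (sym (∑-updateAt w (h zero)))
    (+-monoʳ-≤ (w (h zero)) (∑-∘-≤ (h ∘ suc) (suc-injectiveᶠ ∘ h-injective) (updateAt w (h zero) (const 0))))

∑-∘-≡ : ∀ {m n} (h : Fin n → Fin m) → Injective _≡_ _≡_ h → (w : Fin m → ℕ) →
  (∀ u → (∀ i → h i ≢ u) → w u ≡ 0) → ∑ (w ∘ h) ≡ ∑ w
∑-∘-≡ {n = zero} h _ w off-image = sym (∑-zero w λ u → off-image u λ ())
∑-∘-≡ {m} {suc n} h h-injective w off-image = begin
  ∑ (w ∘ h)                          ≡⟨ ∑∘h≡head+∑∘tail h h-injective w ⟩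
  w (h zero) + ∑ (w′ ∘ h ∘ suc)      ≡⟨ cong (w (h zero) +_) (∑-∘-≡ (h ∘ suc) (suc-injectiveᶠ ∘ h-injective) w′ off-tail) ⟩
  w (h zero) + ∑ w′                  ≡⟨ ∑-updateAt w (h zero) ⟨
  ∑ w                                ∎
  where
  w′ : Fin m → ℕ
  w′ = updateAt w (h zero) (const 0)
  off-tail : ∀ u → (∀ i → h (suc i) ≢ u) → w′ u ≡ 0
  off-tail u u∉tail with u ≟ᶠ h zero
  ... | yes refl = updateAt-updates (h zero) w
  ... | no u≢h0 = trans (updateAt-minimal u (h zero) w u≢h0) (off-image u λ
    { zero → u≢h0 ∘ sym ; (suc i) → u∉tail i })

count : ∀ {m} → (Fin m → Bool) → ℕ
count p = ∑ (λ v → if p v then 1 else 0)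

card≡∑count : ∀ {m} {A : FinDigraph m} (Λ : ArcSubset A) → card Λ ≡ ∑ (count ∘ proj₁ Λ)
card≡∑count {m} (Λ , _) =
  trans (cong sum (map-tabulate id λ u → sum (List.map (λ v → if Λ u v then 1 else 0) (List.allFin m))))
        (∑-cong λ u → cong sum (map-tabulate id λ v → if Λ u v then 1 else 0))

module _ {m} {A : FinDigraph m} (Λ : ArcSubset A) {n} (src tgt : Fin n → Fin m)
  (src-injective : Injective _≡_ _≡_ src) (src→tgt∈Λ : ∀ i → proj₁ Λ (src i) (tgt i) ≡ true) where

  n≤card : n ≤ card Λ
  n≤card = subst₂ _≤_ (∑-ones n) (sym (card≡∑count Λ))
    (≤-trans (∑-mono-≤ row-positive) (∑-∘-≤ src src-injective _))
    where
    row-positive : ∀ i → 1 ≤ count (proj₁ Λ (src i))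
    row-positive i = ≤-trans (subst (λ b → 1 ≤ (if b then 1 else 0)) (sym (src→tgt∈Λ i)) ≤-refl)
                             (entry≤∑ _ (tgt i))

  card≡n : (∀ u v → proj₁ Λ u v ≡ true → Σ (Fin n) λ i → u ≡ src i × v ≡ tgt i) → card Λ ≡ n
  card≡n only = begin
    card Λ                           ≡⟨ card≡∑count Λ ⟩
    ∑ (count ∘ proj₁ Λ)              ≡⟨ ∑-∘-≡ src src-injective _ off-source ⟨
    ∑ (count ∘ proj₁ Λ ∘ src)        ≡⟨ ∑-cong row-count ⟩
    ∑ {n} (const 1)                  ≡⟨ ∑-ones n ⟩
    n                                ∎
    where
    off-source : ∀ u → (∀ i → src i ≢ u) → count (proj₁ Λ u) ≡ 0
    off-source u u∉src = ∑-zero _ λ v → case v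
      where
      case : ∀ v → (if proj₁ Λ u v then 1 else 0) ≡ 0
      case v with proj₁ Λ u v in uv∈Λ
      ... | false = refl
      ... | true = let i , u≡ , _ = only u v uv∈Λ in ⊥-elim (u∉src i (sym u≡))

    row-count : ∀ i → count (proj₁ Λ (src i)) ≡ 1
    row-count i = begin
      count (proj₁ Λ (src i))                            ≡⟨ ∑-∘-≡ (const (tgt i)) (λ { {zero} {zero} _ → refl ; {suc ()} ; {_} {suc ()} }) _ off-target ⟨
      (if proj₁ Λ (src i) (tgt i) then 1 else 0) + 0     ≡⟨ cong (λ b → (if b then 1 else 0) + 0) (src→tgt∈Λ i) ⟩
      1                                                  ∎
      where
      off-target : ∀ v → (∀ (_ : Fin 1) → tgt i ≢ v) → (if proj₁ Λ (src i) v then 1 else 0) ≡ 0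
      off-target v v≢tgt with proj₁ Λ (src i) v in e
      ... | false = refl
      ... | true = let i′ , src≡ , v≡ = only _ v e in ⊥-elim (v≢tgt zero (trans (cong tgt (src-injective src≡)) (sym v≡)))

kernel-alternates : ∀ {m} {A : FinDigraph m} (Λ : ArcSubset A) (ker : HasKernel (subdivide A Λ)) {u v : Fin m} →
  A u v ≡ true → proj₁ Λ u v ≡ false → (∀ w → A u w ≡ true → w ≡ v) →
  proj₁ ker (old v) ≡ not (proj₁ ker (old u))
kernel-alternates Λ (N , independent , absorbent) {u} {v} uv∈A uv∉Λ out-unique with N (old u) in u∈?
... | true = Bool.¬-not λ v∈N → independent (old u) (old v) u∈? v∈N (uv∈A , uv∉Λ)
... | false with absorbent (old u) (Bool.not-¬ u∈?)
...   | old w , w∈N , (uw∈A , _) = subst (λ x → N (old x) ≡ true) (out-unique w uw∈A) w∈N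
...   | new _ w uw∈Λ , _ , refl with () ←
  trans (sym uv∉Λ) (subst (λ x → proj₁ Λ u x ≡ true) (out-unique w (proj₂ Λ u w uw∈Λ)) uw∈Λ)

module _ {m} {A : FinDigraph m} where
  open DirCycle

  walk-closed : ∀ (D : DirCycle A) j → A (lookup (walk D) j) (lookup (walk D) (next j)) ≡ true
  walk-closed record { walk = w ; closed = closed } j = recompute (A (lookup w j) (lookup w (next j)) Bool.≟ true) (closed j)

  walk-injective : ∀ (D : DirCycle A) → Injective _≡_ _≡_ (lookup (walk D))
  walk-injective record { distinct = distinct } {j} {j′} e = recompute (j ≟ᶠ j′) (distinct j j′ e)

  walk-least : ∀ (D : DirCycle A) j → toℕ (lookup (walk D) zero) ≤ toℕ (lookup (walk D) j)
  walk-least record { walk = w ; canon = canon } j = recompute (toℕ (lookup w zero) ≤? toℕ (lookup w j)) (canon j)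

  walk-entered : ∀ (D : DirCycle A) → A (lookup (walk D) (fromℕ (len D))) (lookup (walk D) zero) ≡ true
  walk-entered D = subst (λ j → A (lookup (walk D) (fromℕ (len D))) (lookup (walk D) j) ≡ true)
    (next-fromℕ (len D)) (walk-closed D (fromℕ (len D)))

DirCycle-≡ : ∀ {m} {A : FinDigraph m} (D E : DirCycle A) → DirCycle.len D ≡ DirCycle.len E →
  (∀ k (k<D : k < suc (DirCycle.len D)) (k<E : k < suc (DirCycle.len E)) →
     lookup (DirCycle.walk D) (fromℕ< k<D) ≡ lookup (DirCycle.walk E) (fromℕ< k<E)) →
  D ≡ E
DirCycle-≡ record { walk = w } record { walk = w′ } refl same
  with refl ← trans (sym (tabulate∘lookup w)) (trans (tabulate-cong λ j →
                subst (λ x → lookup w x ≡ lookup w′ x) (fromℕ<-toℕ j (toℕ<n j)) (same (toℕ j) (toℕ<n j) (toℕ<n j)))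
              (tabulate∘lookup w′)) = refl

argmin : ∀ {K} (f : Fin (suc K) → ℕ) → Σ (Fin (suc K)) λ j → ∀ j′ → f j ≤ f j′
argmin {zero} f = zero , λ { zero → ≤-refl }
argmin {suc K} f with argmin (f ∘ suc) | f zero ≤? f (suc (proj₁ (argmin (f ∘ suc))))
... | j , least | yes f0≤ = zero , λ { zero → ≤-refl ; (suc j′) → ≤-trans f0≤ (least j′) }
... | j , least | no f0≰ = suc j , λ { zero → <⇒≤ (≰⇒> f0≰) ; (suc j′) → least j′ }

-- A directed cycle γ all of whose vertices have out-degree one is the only
-- directed cycle through any of its vertices.
module OutDegreeOneCycle {m} (A : FinDigraph m) {K : ℕ} (γ : Fin (suc K) → Fin m)
  (γ-injective : Injective _≡_ _≡_ γ)
  (γ-arc : ∀ j → A (γ j) (γ (next j)) ≡ true)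
  (γ-out : ∀ j v → A (γ j) v ≡ true → v ≡ γ (next j)) where

  start : Fin (suc K)
  start = proj₁ (argmin (toℕ ∘ γ))

  start-least : ∀ j → toℕ (γ start) ≤ toℕ (γ j)
  start-least = proj₂ (argmin (toℕ ∘ γ))

  around : Fin (suc K) → Fin m
  around k = γ (next^ (toℕ k) start)

  around-arc : ∀ k → A (around k) (around (next k)) ≡ true
  around-arc k = subst (λ x → A (around k) (γ x) ≡ true) (sym (next^-toℕ-next start k)) (γ-arc _)

  cycle : DirCycle A
  cycle = record
    { len = K
    ; walk = Vec.tabulate around
    ; distinct = λ k k′ e → toℕ-injective (next^-injective start (toℕ<n k) (toℕ<n k′) (γ-injective
        (trans (sym (lookup∘tabulate around k)) (trans e (lookup∘tabulate around k′)))))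
    ; closed = λ k → subst₂ (λ x y → A x y ≡ true) (sym (lookup∘tabulate around k))
        (sym (lookup∘tabulate around (next k))) (around-arc k)
    ; canon = λ k → subst (λ x → toℕ (γ start) ≤ toℕ x) (sym (lookup∘tabulate around k))
        (start-least (next^ (toℕ k) start))
    }

  module _ (D : DirCycle A) (s : Fin (suc K)) (starts-at : lookup (DirCycle.walk D) zero ≡ γ s) where
    open DirCycle D using (len; walk)

    walk-follows : ∀ k → lookup walk (next^ k zero) ≡ γ (next^ k s)
    walk-follows zero = starts-at
    walk-follows (suc k) = γ-out (next^ k s) _
      (subst (λ x → A x (lookup walk (next^ (suc k) zero)) ≡ true) (walk-follows k) (walk-closed D (next^ k zero)))

    len≡K : len ≡ K
    len≡K with <-cmp len K
    ... | tri≈ _ len≡K _ = len≡K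
    ... | tri< len<K _ _ = ⊥-elim (0≢1+n (next^-injective s (s≤s z≤n) (s≤s len<K) (γ-injective (begin
      γ s                             ≡⟨ starts-at ⟨
      lookup walk zero                ≡⟨ cong (lookup walk) (next^-period zero) ⟨
      lookup walk (next^ (suc len) zero) ≡⟨ walk-follows (suc len) ⟩
      γ (next^ (suc len) s)           ∎))))
    ... | tri> _ _ K<len = ⊥-elim (0≢1+n (next^-injective zero (s≤s z≤n) (s≤s K<len) (walk-injective D (begin
      lookup walk zero                ≡⟨ starts-at ⟩
      γ s                             ≡⟨ cong γ (next^-period s) ⟨
      γ (next^ (suc K) s)             ≡⟨ walk-follows (suc K) ⟨
      lookup walk (next^ (suc K) zero) ∎))))

    s≡start : s ≡ start
    s≡start = γ-injective (toℕ-injective (≤-antisym (s-least start) (start-least s)))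
      where
      s-least : ∀ j → toℕ (γ s) ≤ toℕ (γ j)
      s-least j = let k , _ , next^k≡j = next^-surjective s j in
        subst₂ (λ x y → toℕ x ≤ toℕ y) starts-at (trans (walk-follows k) (cong γ next^k≡j))
          (walk-least D (next^ k zero))

    cycle-unique : D ≡ cycle
    cycle-unique = DirCycle-≡ D cycle len≡K λ k k<D k<K → begin
      lookup walk (fromℕ< k<D)             ≡⟨ cong (lookup walk) (next^-zero k k<D) ⟨
      lookup walk (next^ k zero)           ≡⟨ walk-follows k ⟩
      γ (next^ k s)                        ≡⟨ cong (λ x → γ (next^ k x)) s≡start ⟩
      γ (next^ k start)                    ≡⟨ cong (λ x → γ (next^ x start)) (toℕ-fromℕ< k<K) ⟨
      around (fromℕ< k<K)                  ≡⟨ lookup∘tabulate around (fromℕ< k<K) ⟨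
      lookup (Vec.tabulate around) (fromℕ< k<K) ∎

-- The star of odd cycles

module StarOfOddCycles (n : ℕ) (t : Fin n → ℕ) (m : ℕ) (A : FinDigraph m) (c : Fin m)
  (cyc : Σ (Fin n) (λ i → Fin (3 + 2 * t i)) → Fin m)
  (cyc-injective : ∀ p q → cyc p ≡ cyc q → p ≡ q)
  (cyc≢c : ∀ p → ¬ (cyc p ≡ c))
  (cyc-onto : ∀ v → ¬ (v ≡ c) → Σ (Σ (Fin n) (λ i → Fin (3 + 2 * t i))) λ p → cyc p ≡ v)
  (arc⇔ : ∀ u v → (A u v ≡ true) ⇔
      ((u ≡ c × Σ (Fin n) λ i → v ≡ cyc (i , zero)) ⊎
       Σ (Σ (Fin n) (λ i → Fin (3 + 2 * t i))) λ p →
         u ≡ cyc p × v ≡ cyc (proj₁ p , next (proj₂ p)))) where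

  γ : ∀ i → Fin (3 + 2 * t i) → Fin m
  γ i j = cyc (i , j)

  last : ∀ i → Fin (3 + 2 * t i)
  last i = fromℕ (2 + 2 * t i)

  γ-injective : ∀ i → Injective _≡_ _≡_ (γ i)
  γ-injective i e = ,-injectiveʳ-UIP (Decidable⇒UIP.≡-irrelevant _≟ᶠ_) (cyc-injective _ _ e)

  γ-disjoint : ∀ (f : ∀ i → Fin (3 + 2 * t i)) → Injective _≡_ _≡_ (λ i → γ i (f i))
  γ-disjoint f e = cong proj₁ (cyc-injective _ _ e)

  γ-arc : ∀ i j → A (γ i j) (γ i (next j)) ≡ true
  γ-arc i j = Equivalence.from (arc⇔ _ _) (inj₂ ((i , j) , refl , refl))

  γ-out : ∀ i j v → A (γ i j) v ≡ true → v ≡ γ i (next j)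
  γ-out i j v γij→v with Equivalence.to (arc⇔ _ _) γij→v
  ... | inj₁ (γij≡c , _) = ⊥-elim (cyc≢c _ γij≡c)
  ... | inj₂ (p , γij≡p , v≡) with refl ← cyc-injective _ _ γij≡p = v≡

  no-arc-into-c : ∀ u → A u c ≢ true
  no-arc-into-c u u→c with Equivalence.to (arc⇔ _ _) u→c
  ... | inj₁ (_ , _ , c≡) = cyc≢c _ (sym c≡)
  ... | inj₂ (_ , _ , c≡) = cyc≢c _ (sym c≡)

  module Cycle (i : Fin n) = OutDegreeOneCycle A (γ i) (γ-injective i) (γ-arc i) (γ-out i)

  first≢c : ∀ (D : DirCycle A) → lookup (DirCycle.walk D) zero ≢ c
  first≢c D first≡c = no-arc-into-c _
    (subst (λ x → A (lookup (DirCycle.walk D) (fromℕ (DirCycle.len D))) x ≡ true) first≡c (walk-entered D))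

  cycleIndex : DirCycle A → Fin n
  cycleIndex D = proj₁ (proj₁ (cyc-onto _ (first≢c D)))

  cycles : Fin n ↔ DirCycle A
  cycles = mk↔ₛ′ Cycle.cycle cycleIndex cycle-cycleIndex cycleIndex-cycle
    where
    cycle-cycleIndex : ∀ D → Cycle.cycle (cycleIndex D) ≡ D
    cycle-cycleIndex D = let (i , s) , γis≡first = cyc-onto _ (first≢c D) in
      sym (Cycle.cycle-unique i D s (sym γis≡first))
    cycleIndex-cycle : ∀ i → cycleIndex (Cycle.cycle i) ≡ i
    cycleIndex-cycle i = cong proj₁ (cyc-injective _ _ (proj₂ (cyc-onto _ (first≢c (Cycle.cycle i)))))

  Λ₀-rel : Fin m → Fin m → Bool
  Λ₀-rel u v = does (any? λ i → (u ≟ᶠ γ i (last i)) ×-dec (v ≟ᶠ γ i zero))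

  Λ₀-sound : ∀ u v → Λ₀-rel u v ≡ true → Σ (Fin n) λ i → u ≡ γ i (last i) × v ≡ γ i zero
  Λ₀-sound u v uv∈Λ₀ with any? (λ i → (u ≟ᶠ γ i (last i)) ×-dec (v ≟ᶠ γ i zero))
  ... | yes found = found

  Λ₀-complete : ∀ i → Λ₀-rel (γ i (last i)) (γ i zero) ≡ true
  Λ₀-complete i = dec-true (any? _) (i , refl , refl)

  Λ₀ : ArcSubset A
  Λ₀ = Λ₀-rel , λ u v uv∈Λ₀ → let i , u≡ , v≡ = Λ₀-sound u v uv∈Λ₀ in
    subst₂ (λ x y → A x y ≡ true) (sym u≡) (trans (cong (γ i) (next-fromℕ _)) (sym v≡)) (γ-arc i (last i))

  card-Λ₀ : card Λ₀ ≡ n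
  card-Λ₀ = card≡n Λ₀ (λ i → γ i (last i)) (λ i → γ i zero) (γ-disjoint last) Λ₀-complete Λ₀-sound

  ∉Λ₀ : ∀ i j v → toℕ j < 2 + 2 * t i → Λ₀-rel (γ i j) v ≡ false
  ∉Λ₀ i j v j<last with Λ₀-rel (γ i j) v in γij→v∈Λ₀
  ... | false = refl
  ... | true with _ , γij≡ , _ ← Λ₀-sound _ _ γij→v∈Λ₀ with refl ← cyc-injective _ _ γij≡ =
    ⊥-elim (<-irrefl (toℕ-fromℕ _) j<last)

  N₀ : SubVertex A Λ₀ → Bool
  N₀ (old x) with x ≟ᶠ c
  ... | yes _ = true
  ... | no x≢c = odd (toℕ (proj₂ (proj₁ (cyc-onto x x≢c))))
  N₀ (new _ _ _) = true

  N₀-γ : ∀ i j → N₀ (old (γ i j)) ≡ odd (toℕ j)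
  N₀-γ i j with γ i j ≟ᶠ c
  ... | yes γij≡c = ⊥-elim (cyc≢c _ γij≡c)
  ... | no γij≢c with p , γij≡p ← cyc-onto (γ i j) γij≢c with refl ← cyc-injective _ _ γij≡p = refl

  N₀-independent : ∀ a b → N₀ a ≡ true → N₀ b ≡ true → ¬ SubArc A Λ₀ a b
  N₀-independent (old x) (old y) x∈N₀ y∈N₀ (x→y , _) with Equivalence.to (arc⇔ x y) x→y
  ... | inj₁ (_ , i , refl) with () ← trans (sym y∈N₀) (N₀-γ i zero)
  ... | inj₂ ((i , j) , refl , refl) with () ←
    trans (sym y∈N₀) (trans (N₀-γ i (next j)) (odd-next (t i) j (trans (sym (N₀-γ i j)) x∈N₀)))
  N₀-independent (old x) (new u v uv∈Λ₀) x∈N₀ _ refl with i , refl , _ ← Λ₀-sound u v uv∈Λ₀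
    with () ← trans (sym x∈N₀) (trans (N₀-γ i (last i)) (trans (cong odd (toℕ-fromℕ (2 + 2 * t i))) (odd-2+2* (t i))))
  N₀-independent (new u v uv∈Λ₀) (old y) _ y∈N₀ refl with i , _ , refl ← Λ₀-sound u v uv∈Λ₀
    with () ← trans (sym y∈N₀) (N₀-γ i zero)

  N₀-absorbs-γ : ∀ i j → odd (toℕ j) ≡ false → Σ (SubVertex A Λ₀) λ b → N₀ b ≡ true × SubArc A Λ₀ (old (γ i j)) b
  N₀-absorbs-γ i j even-j with next-cases j
  ... | inj₁ (j<last , toℕ-next≡) =
    old (γ i (next j)) , trans (N₀-γ i (next j)) (trans (cong odd toℕ-next≡) (cong not even-j)) ,
    γ-arc i j , ∉Λ₀ i j _ j<last
  ... | inj₂ (j≡last , _) with refl ← toℕ-injective {j = last i} (trans j≡last (sym (toℕ-fromℕ _))) =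
    new (γ i (last i)) (γ i zero) (Λ₀-complete i) , refl , refl

  N₀-absorbent : ∀ a → N₀ a ≢ true → Σ (SubVertex A Λ₀) λ b → N₀ b ≡ true × SubArc A Λ₀ a b
  N₀-absorbent (new _ _ _) ∉N₀ = ⊥-elim (∉N₀ refl)
  N₀-absorbent (old x) ∉N₀ with x ≟ᶠ c
  ... | yes _ = ⊥-elim (∉N₀ refl)
  ... | no x≢c with (i , j) , refl ← cyc-onto x x≢c = N₀-absorbs-γ i j (Bool.¬-not ∉N₀)

  kernel-Λ₀ : HasKernel (subdivide A Λ₀)
  kernel-Λ₀ = N₀ , N₀-independent , N₀-absorbent

  kernel⇒n≤card : ∀ Λ → HasKernel (subdivide A Λ) → n ≤ card Λ
  kernel⇒n≤card Λ ker = n≤card Λ (λ i → γ i (proj₁ (subdivided i))) (λ i → γ i (next (proj₁ (subdivided i))))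
    (γ-disjoint (proj₁ ∘ subdivided)) (proj₂ ∘ subdivided)
    where
    subdivided : ∀ i → Σ (Fin (3 + 2 * t i)) λ j → proj₁ Λ (γ i j) (γ i (next j)) ≡ true
    subdivided i with any? (λ j → proj₁ Λ (γ i j) (γ i (next j)) Bool.≟ true)
    ... | yes found = found
    ... | no none = ⊥-elim (odd-cycle-not-alternating (t i) (λ j → proj₁ ker (old (γ i j))) λ j →
      kernel-alternates Λ ker (γ-arc i j) (Bool.¬-not (none ∘ (j ,_))) (γ-out i j))

mainTheorem5 : (n : ℕ) → 2 ≤ n → (t : Fin n → ℕ) →
    (m : ℕ) (A : FinDigraph m) (c : Fin m) →
    (cyc : Σ (Fin n) (λ i → Fin (3 + 2 * t i)) → Fin m) →
    (∀ p q → cyc p ≡ cyc q → p ≡ q) →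
    (∀ p → ¬ (cyc p ≡ c)) →
    (∀ v → ¬ (v ≡ c) → Σ (Σ (Fin n) (λ i → Fin (3 + 2 * t i))) λ p → cyc p ≡ v) →
    (∀ u v → (A u v ≡ true) ⇔
      ((u ≡ c × Σ (Fin n) λ i → v ≡ cyc (i , zero)) ⊎
       Σ (Σ (Fin n) (λ i → Fin (3 + 2 * t i))) λ p →
         u ≡ cyc p × v ≡ cyc (proj₁ p , next (proj₂ p)))) →
    Σ ℕ λ k → (Fin k ↔ DirCycle A) × IsKappa A k
mainTheorem5 n _ t m A c cyc cyc-injective cyc≢c cyc-onto arc⇔ =
  n , cycles , (Λ₀ , card-Λ₀ , kernel-Λ₀) , kernel⇒n≤card
  where open StarOfOddCycles n t m A c cyc cyc-injective cyc≢c cyc-onto arc⇔
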